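{- If $(\mathsf{DiGraph},\otimes,J_0)$ is a biclosed monoidal category, then the directed graph $J_1\otimes J_1$ has exactly four vertices and contains the commutative-square graph $C_{Sq}$ as a subgraph.
   Context: $\mathsf{DiGraph}$ is the category of directed reflexive graphs: sets with a reflexive relation $\rightsquigarrow$, and relation-preserving functions. $J_n$ denotes the directed graph with vertices $0,\dots,n$ and edges $i\rightsquigarrow i+1$ for $i<n$ (plus loops). So $J_0$ is a single vertex and $J_1$ is a single directed edge between two vertices. $C_{Sq}$ is the directed graph with four vertices $a,b,c,d$ and (non-loop) edges $a\rightsquigarrow b$, $a\rightsquigarrow c$, $b\rightsquigarrow d$, $c\rightsquigarrow d$. A monoidal category is biclosed if for every object $X$ both $X\otimes-$ and $-\otimes X$ have right adjoints. -}

module Defs where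

open import Data.Nat using (ℕ; zero; suc)
open import Data.Fin using (Fin; toℕ)
open import Data.Unit using (⊤; tt)
open import Data.Sum using (_⊎_; inj₁)
open import Data.Product using (Σ; _×_)
open import Relation.Binary.PropositionalEquality using (_≡_; refl)
open import Function.Bundles using (_↔_)

record Graph : Set₁ where
  field
    V    : Set
    _⇝_  : V → V → Set
    ⇝-refl : ∀ x → x ⇝ x
open Graph public

record Hom (G H : Graph) : Set where
  field
    fun  : V G → V H
    pres : ∀ {x y} → _⇝_ G x y → _⇝_ H (fun x) (fun y)
open Hom public

infix 4 _≈_
_≈_ : ∀ {G H} → Hom G H → Hom G H → Set
f ≈ g = ∀ x → fun f x ≡ fun g x

idH : ∀ {G} → Hom G G
idH = record { fun = λ x → x ; pres = λ e → e }

infixr 9 _∘H_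
_∘H_ : ∀ {G H K} → Hom H K → Hom G H → Hom G K
g ∘H f = record { fun = λ x → fun g (fun f x) ; pres = λ e → pres g (pres f e) }

record Iso (A B : Graph) : Set where
  field
    to   : Hom A B
    from : Hom B A
    to∘from : to ∘H from ≈ idH
    from∘to : from ∘H to ≈ idH
open Iso public

record Monoidal (I : Graph) : Set₁ where
  infixr 10 _⊗₀_ _⊗₁_
  field
    _⊗₀_ : Graph → Graph → Graph
    _⊗₁_ : ∀ {A B C D} → Hom A B → Hom C D → Hom (A ⊗₀ C) (B ⊗₀ D)
    ⊗-resp-≈ : ∀ {A B C D} {f f' : Hom A B} {g g' : Hom C D} →
               f ≈ f' → g ≈ g' → f ⊗₁ g ≈ f' ⊗₁ g'
    ⊗-id : ∀ {A C} → idH {A} ⊗₁ idH {C} ≈ idH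
    ⊗-∘  : ∀ {A B C D E F} {f : Hom A B} {g : Hom B C} {h : Hom D E} {k : Hom E F} →
           (g ∘H f) ⊗₁ (k ∘H h) ≈ (g ⊗₁ k) ∘H (f ⊗₁ h)
    assoc   : ∀ {A B C} → Iso ((A ⊗₀ B) ⊗₀ C) (A ⊗₀ (B ⊗₀ C))
    unitorˡ : ∀ {A} → Iso (I ⊗₀ A) A
    unitorʳ : ∀ {A} → Iso (A ⊗₀ I) A
    assoc-natural : ∀ {A B C A' B' C'} {f : Hom A A'} {g : Hom B B'} {h : Hom C C'} →
      to (assoc {A'} {B'} {C'}) ∘H ((f ⊗₁ g) ⊗₁ h) ≈ (f ⊗₁ (g ⊗₁ h)) ∘H to (assoc {A} {B} {C})
    unitorˡ-natural : ∀ {A B} {f : Hom A B} →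
      f ∘H to (unitorˡ {A}) ≈ to (unitorˡ {B}) ∘H (idH {I} ⊗₁ f)
    unitorʳ-natural : ∀ {A B} {f : Hom A B} →
      f ∘H to (unitorʳ {A}) ≈ to (unitorʳ {B}) ∘H (f ⊗₁ idH {I})
    pentagon : ∀ {A B C D} →
      to (assoc {A} {B} {C ⊗₀ D}) ∘H to (assoc {A ⊗₀ B} {C} {D})
        ≈ (idH {A} ⊗₁ to (assoc {B} {C} {D})) ∘H to (assoc {A} {B ⊗₀ C} {D})
            ∘H (to (assoc {A} {B} {C}) ⊗₁ idH {D})
    triangle : ∀ {A B} →
      (idH {A} ⊗₁ to (unitorˡ {B})) ∘H to (assoc {A} {I} {B}) ≈ to (unitorʳ {A}) ⊗₁ idH {B}

-- Right adjoints, presented by universal arrows (evaluation maps).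
module _ {I : Graph} (M : Monoidal I) where
  open Monoidal M

  record LeftClosed (X : Graph) : Set₁ where
    field
      [_,_]ˡ : Graph → Graph
      evˡ    : ∀ {B} → Hom (X ⊗₀ [_,_]ˡ B) B
      curryˡ : ∀ {A B} → Hom (X ⊗₀ A) B → Hom A ([_,_]ˡ B)
      curryˡ-β : ∀ {A B} (f : Hom (X ⊗₀ A) B) → evˡ ∘H (idH ⊗₁ curryˡ f) ≈ f
      curryˡ-unique : ∀ {A B} (f : Hom (X ⊗₀ A) B) (g : Hom A ([_,_]ˡ B)) →
        evˡ ∘H (idH ⊗₁ g) ≈ f → g ≈ curryˡ f

  record RightClosed (X : Graph) : Set₁ where
    field
      [_,_]ʳ : Graph → Graph
      evʳ    : ∀ {B} → Hom ([_,_]ʳ B ⊗₀ X) B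
      curryʳ : ∀ {A B} → Hom (A ⊗₀ X) B → Hom A ([_,_]ʳ B)
      curryʳ-β : ∀ {A B} (f : Hom (A ⊗₀ X) B) → evʳ ∘H (curryʳ f ⊗₁ idH) ≈ f
      curryʳ-unique : ∀ {A B} (f : Hom (A ⊗₀ X) B) (g : Hom A ([_,_]ʳ B)) →
        evʳ ∘H (g ⊗₁ idH) ≈ f → g ≈ curryʳ f

  record Biclosed : Set₁ where
    field
      leftClosed  : ∀ X → LeftClosed X
      rightClosed : ∀ X → RightClosed X

J : ℕ → Graph
J n = record
  { V = Fin (suc n)
  ; _⇝_ = λ i j → (toℕ j ≡ toℕ i) ⊎ (toℕ j ≡ suc (toℕ i))
  ; ⇝-refl = λ _ → inj₁ refl
  }

data SqV : Set where
  a b c d : SqV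

data SqE : SqV → SqV → Set where
  loop : ∀ x → SqE x x
  a⇝b : SqE a b
  a⇝c : SqE a c
  b⇝d : SqE b d
  c⇝d : SqE c d

CSq : Graph
CSq = record { V = SqV ; _⇝_ = SqE ; ⇝-refl = loop }

_⊆G_ : Graph → Graph → Set
G ⊆G H = Σ (Hom G H) λ f → ∀ x y → fun f x ≡ fun f y → x ≡ y

{-# OPTIONS --safe #-}
module Submission where

open import Defs
open import Data.Fin using (Fin; zero; suc)
open import Data.Fin.Properties using (*↔×)
open import Data.Product using (_×_; _,_; uncurry)
open import Data.Sum using (inj₁; inj₂)
open import Data.Unit using (⊤; tt)
open import Function.Bundles using (_↔_; mk↔ₛ′)
open import Function.Properties.Inverse using (↔-sym; ↔-trans)
open import Relation.Binary.PropositionalEquality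
  using (_≡_; refl; sym; trans; cong; cong₂; subst₂; module ≡-Reasoning)
open ≡-Reasoning

-- Since the unit J₀ has a single vertex, the vertices of a graph B are the maps J₀ → B, and
-- u ⊗ v : J₀ ⊗ J₀ → A ⊗ B picks out a vertex pair u v of A ⊗ B; tensoring with the maps to J₀
-- and applying the unitors recovers u and v. Conversely, the maps J₀ → B are jointly epic and
-- A ⊗ - preserves this as a left adjoint, so every vertex of A ⊗ B is a pair. Hence
-- V (J₁ ⊗ J₁) ≅ Fin 2 × Fin 2, and the edges 0 ⇝ 1 of the copies J₁ ⊗ v and u ⊗ J₁ form
-- the square.

Indiscrete : Set → Graph
Indiscrete S = record { V = S ; _⇝_ = λ _ _ → ⊤ ; ⇝-refl = λ _ → tt }

toIndiscrete : ∀ {G S} → (V G → S) → Hom G (Indiscrete S)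
toIndiscrete f = record { fun = f ; pres = λ _ → tt }

J₀-vertex-unique : (x y : V (J 0)) → x ≡ y
J₀-vertex-unique zero zero = refl

from-natural : ∀ {A A' B B'} (i : Iso A A') (j : Iso B B') {f : Hom A' B'} {g : Hom A B} →
  f ∘H to i ≈ to j ∘H g → from j ∘H f ≈ g ∘H from i
from-natural i j {f} {g} f∘i≈j∘g x = begin
  fun (from j) (fun f x)
    ≡⟨ cong (λ z → fun (from j) (fun f z)) (sym (to∘from i x)) ⟩
  fun (from j) (fun f (fun (to i) (fun (from i) x)))
    ≡⟨ cong (fun (from j)) (f∘i≈j∘g (fun (from i) x)) ⟩
  fun (from j) (fun (to j) (fun g (fun (from i) x)))
    ≡⟨ from∘to j _ ⟩
  fun g (fun (from i) x) ∎

point : ∀ {A} → V A → Hom (J 0) A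
point {A} u = record { fun = λ _ → u ; pres = λ _ → ⇝-refl A u }

! : ∀ {A} → Hom A (J 0)
! = record { fun = λ _ → zero ; pres = λ _ → inj₁ refl }

!∘point : ∀ {A} (u : V A) → ! ∘H point {A} u ≈ idH
!∘point u zero = refl

module PointedTensor (M : Monoidal (J 0)) where
  open Monoidal M

  J₀⊗J₀-vertex-unique : (x y : V (J 0 ⊗₀ J 0)) → x ≡ y
  J₀⊗J₀-vertex-unique x y = begin
    x                                       ≡⟨ sym (from∘to unitorˡ x) ⟩
    fun (from unitorˡ) (fun (to unitorˡ) x) ≡⟨ cong (fun (from unitorˡ)) (J₀-vertex-unique _ _) ⟩
    fun (from unitorˡ) (fun (to unitorˡ) y) ≡⟨ from∘to unitorˡ y ⟩
    y                                       ∎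

  unitorʳ⁻¹-natural : ∀ {A B} (f : Hom A B) →
    from unitorʳ ∘H f ≈ (f ⊗₁ idH {J 0}) ∘H from unitorʳ
  unitorʳ⁻¹-natural f = from-natural unitorʳ unitorʳ {f} {f ⊗₁ idH} unitorʳ-natural

  unitorˡ⁻¹-natural : ∀ {A B} (f : Hom A B) →
    from unitorˡ ∘H f ≈ (idH {J 0} ⊗₁ f) ∘H from unitorˡ
  unitorˡ⁻¹-natural f = from-natural unitorˡ unitorˡ {f} {idH ⊗₁ f} unitorˡ-natural

  module Pairing (A B : Graph) where

    idH⊗point : V B → Hom (A ⊗₀ J 0) (A ⊗₀ B)
    idH⊗point v = idH ⊗₁ point v

    point⊗idH : V A → Hom (J 0 ⊗₀ B) (A ⊗₀ B)
    point⊗idH u = point u ⊗₁ idH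

    pair : V A → V B → V (A ⊗₀ B)
    pair u v = fun (point u ⊗₁ point v) (fun (from unitorˡ) zero)

    fst : V (A ⊗₀ B) → V A
    fst z = fun (to unitorʳ) (fun (idH {A} ⊗₁ ! {B}) z)

    snd : V (A ⊗₀ B) → V B
    snd z = fun (to unitorˡ) (fun (! {A} ⊗₁ idH {B}) z)

    pair≡idH⊗point : ∀ u v → pair u v ≡ fun (idH⊗point v) (fun (from unitorʳ) u)
    pair≡idH⊗point u v = begin
      fun (point u ⊗₁ point v) (fun (from unitorˡ) zero)
        ≡⟨ cong (fun (point u ⊗₁ point v)) (J₀⊗J₀-vertex-unique _ _) ⟩
      fun (point u ⊗₁ point v) (fun (from unitorʳ) zero)
        ≡⟨ ⊗-∘ {f = point u} {g = idH} {h = idH} {k = point v} _ ⟩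
      fun (idH⊗point v) (fun (point u ⊗₁ idH) (fun (from unitorʳ) zero))
        ≡⟨ cong (fun (idH⊗point v)) (sym (unitorʳ⁻¹-natural (point u) zero)) ⟩
      fun (idH⊗point v) (fun (from unitorʳ) u) ∎

    pair≡point⊗idH : ∀ u v → pair u v ≡ fun (point⊗idH u) (fun (from unitorˡ) v)
    pair≡point⊗idH u v = begin
      fun (point u ⊗₁ point v) (fun (from unitorˡ) zero)
        ≡⟨ ⊗-∘ {f = idH} {g = point u} {h = point v} {k = idH} _ ⟩
      fun (point⊗idH u) (fun (idH ⊗₁ point v) (fun (from unitorˡ) zero))
        ≡⟨ cong (fun (point⊗idH u)) (sym (unitorˡ⁻¹-natural (point v) zero)) ⟩
      fun (point⊗idH u) (fun (from unitorˡ) v) ∎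

    fst-idH⊗point : ∀ v x → fst (fun (idH⊗point v) x) ≡ fun (to unitorʳ) x
    fst-idH⊗point v x = cong (fun (to unitorʳ)) (begin
      fun (idH ⊗₁ !) (fun (idH⊗point v) x)
        ≡⟨ sym (⊗-∘ {f = idH} {g = idH} {h = point v} {k = !} x) ⟩
      fun (idH ⊗₁ (! {B} ∘H point v)) x
        ≡⟨ ⊗-resp-≈ {f = idH {A}} {f' = idH} (λ _ → refl) (!∘point {B} v) x ⟩
      fun (idH ⊗₁ idH) x
        ≡⟨ ⊗-id x ⟩
      x ∎)

    snd-idH⊗point : ∀ v x → snd (fun (idH⊗point v) x) ≡ v
    snd-idH⊗point v x = begin
      fun (to unitorˡ) (fun (! ⊗₁ idH) (fun (idH⊗point v) x))
        ≡⟨ cong (fun (to unitorˡ)) (sym (⊗-∘ {f = idH} {g = !} {h = point v} {k = idH} x)) ⟩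
      fun (to unitorˡ) (fun (! ⊗₁ point v) x)
        ≡⟨ cong (fun (to unitorˡ)) (⊗-∘ {f = !} {g = idH} {h = idH} {k = point v} x) ⟩
      fun (to unitorˡ) (fun (idH ⊗₁ point v) (fun (! ⊗₁ idH) x))
        ≡⟨ sym (unitorˡ-natural (fun (! ⊗₁ idH) x)) ⟩
      v ∎

    fst-pair : ∀ u v → fst (pair u v) ≡ u
    fst-pair u v = begin
      fst (pair u v)                                 ≡⟨ cong fst (pair≡idH⊗point u v) ⟩
      fst (fun (idH⊗point v) (fun (from unitorʳ) u)) ≡⟨ fst-idH⊗point v _ ⟩
      fun (to unitorʳ) (fun (from unitorʳ) u)        ≡⟨ to∘from unitorʳ u ⟩
      u                                              ∎

    snd-pair : ∀ u v → snd (pair u v) ≡ v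
    snd-pair u v = trans (cong snd (pair≡idH⊗point u v)) (snd-idH⊗point v _)

    pair-injective : ∀ {u u' v v'} → pair u v ≡ pair u' v' → (u , v) ≡ (u' , v')
    pair-injective {u} {u'} {v} {v'} eq = cong₂ _,_
      (trans (sym (fst-pair u v)) (trans (cong fst eq) (fst-pair u' v')))
      (trans (sym (snd-pair u v)) (trans (cong snd eq) (snd-pair u' v')))

    pair-⇝ˡ : ∀ {u u'} v → _⇝_ A u u' → _⇝_ (A ⊗₀ B) (pair u v) (pair u' v)
    pair-⇝ˡ {u} {u'} v e =
      subst₂ (_⇝_ (A ⊗₀ B)) (sym (pair≡idH⊗point u v)) (sym (pair≡idH⊗point u' v))
        (pres (idH⊗point v) (pres (from unitorʳ) e))

    pair-⇝ʳ : ∀ u {v v'} → _⇝_ B v v' → _⇝_ (A ⊗₀ B) (pair u v) (pair u v')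
    pair-⇝ʳ u {v} {v'} e =
      subst₂ (_⇝_ (A ⊗₀ B)) (sym (pair≡point⊗idH u v)) (sym (pair≡point⊗idH u v'))
        (pres (point⊗idH u) (pres (from unitorˡ) e))

  module _ {A : Graph} (closed : LeftClosed M A) where
    open LeftClosed closed

    curryˡ-resp-≈ : ∀ {C D} {f g : Hom (A ⊗₀ C) D} → f ≈ g → curryˡ f ≈ curryˡ g
    curryˡ-resp-≈ {f = f} {g} f≈g =
      curryˡ-unique g (curryˡ f) (λ x → trans (curryˡ-β f x) (f≈g x))

    curryˡ-natural : ∀ {C C' D} (f : Hom (A ⊗₀ C) D) (g : Hom C' C) →
      curryˡ f ∘H g ≈ curryˡ (f ∘H (idH ⊗₁ g))
    curryˡ-natural f g = curryˡ-unique (f ∘H (idH ⊗₁ g)) (curryˡ f ∘H g) (λ x →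
      trans (cong (fun evˡ) (⊗-∘ {f = idH} {g = idH} {h = g} {k = curryˡ f} x))
            (curryˡ-β f (fun (idH ⊗₁ g) x)))

    module _ (B : Graph) where
      open Pairing A B

      idH⊗point-jointly-epic : ∀ {D} (f g : Hom (A ⊗₀ B) D) →
        (∀ v → f ∘H idH⊗point v ≈ g ∘H idH⊗point v) → f ≈ g
      idH⊗point-jointly-epic f g agree x = begin
        fun f x
          ≡⟨ sym (curryˡ-β f x) ⟩
        fun evˡ (fun (idH ⊗₁ curryˡ f) x)
          ≡⟨ cong (fun evˡ) (⊗-resp-≈ {f = idH} {f' = idH} (λ _ → refl) curried x) ⟩
        fun evˡ (fun (idH ⊗₁ curryˡ g) x)
          ≡⟨ curryˡ-β g x ⟩
        fun g x ∎
        where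
        curried : curryˡ f ≈ curryˡ g
        curried v = begin
          fun (curryˡ f) v                       ≡⟨ curryˡ-natural f (point v) zero ⟩
          fun (curryˡ (f ∘H idH⊗point v)) zero   ≡⟨ curryˡ-resp-≈ (agree v) zero ⟩
          fun (curryˡ (g ∘H idH⊗point v)) zero   ≡⟨ sym (curryˡ-natural g (point v) zero) ⟩
          fun (curryˡ g) v                       ∎

      -- Compared as maps into an indiscrete graph, so that any function counts as a morphism.
      pair-fst-snd : ∀ z → pair (fst z) (snd z) ≡ z
      pair-fst-snd = idH⊗point-jointly-epic
        (toIndiscrete (λ z → pair (fst z) (snd z))) (toIndiscrete (λ z → z))
        (λ v x → begin
          pair (fst (fun (idH⊗point v) x)) (snd (fun (idH⊗point v) x))
            ≡⟨ cong₂ pair (fst-idH⊗point v x) (snd-idH⊗point v x) ⟩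
          pair (fun (to unitorʳ) x) v
            ≡⟨ pair≡idH⊗point _ v ⟩
          fun (idH⊗point v) (fun (from unitorʳ) (fun (to unitorʳ) x))
            ≡⟨ cong (fun (idH⊗point v)) (from∘to unitorʳ x) ⟩
          fun (idH⊗point v) x ∎)

      vertices-⊗ : V (A ⊗₀ B) ↔ (V A × V B)
      vertices-⊗ = mk↔ₛ′ (λ z → fst z , snd z) (uncurry pair)
        (λ (u , v) → cong₂ _,_ (fst-pair u v) (snd-pair u v))
        pair-fst-snd

square-coords : SqV → Fin 2 × Fin 2
square-coords a = zero , zero
square-coords b = suc zero , zero
square-coords c = zero , suc zero
square-coords d = suc zero , suc zero

square-vertex : Fin 2 → Fin 2 → SqV
square-vertex zero zero = a
square-vertex (suc zero) zero = b
square-vertex zero (suc zero) = c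
square-vertex (suc zero) (suc zero) = d

square-vertex-coords : ∀ x → uncurry square-vertex (square-coords x) ≡ x
square-vertex-coords a = refl
square-vertex-coords b = refl
square-vertex-coords c = refl
square-vertex-coords d = refl

module _ (M : Monoidal (J 0)) where
  open Monoidal M
  open PointedTensor M
  open Pairing (J 1) (J 1) using (pair; pair-injective; pair-⇝ˡ; pair-⇝ʳ)

  square : Hom CSq (J 1 ⊗₀ J 1)
  square = record { fun = vertex ; pres = edge }
    where
    vertex : SqV → V (J 1 ⊗₀ J 1)
    vertex x = uncurry pair (square-coords x)

    0⇝1 : _⇝_ (J 1) zero (suc zero)
    0⇝1 = inj₂ refl

    edge : ∀ {x y} → SqE x y → _⇝_ (J 1 ⊗₀ J 1) (vertex x) (vertex y)
    edge (loop x) = ⇝-refl (J 1 ⊗₀ J 1) _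
    edge a⇝b = pair-⇝ˡ zero 0⇝1
    edge a⇝c = pair-⇝ʳ zero 0⇝1
    edge b⇝d = pair-⇝ʳ (suc zero) 0⇝1
    edge c⇝d = pair-⇝ˡ (suc zero) 0⇝1

  CSq⊆J₁⊗J₁ : CSq ⊆G (J 1 ⊗₀ J 1)
  CSq⊆J₁⊗J₁ = square , λ x y eq → begin
    x                                        ≡⟨ sym (square-vertex-coords x) ⟩
    uncurry square-vertex (square-coords x)  ≡⟨ cong (uncurry square-vertex) (pair-injective eq) ⟩
    uncurry square-vertex (square-coords y)  ≡⟨ square-vertex-coords y ⟩
    y                                        ∎

mainTheorem3 : (M : Monoidal (J 0)) → Biclosed M →
    (V (Monoidal._⊗₀_ M (J 1) (J 1)) ↔ Fin 4) × (CSq ⊆G Monoidal._⊗₀_ M (J 1) (J 1))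
mainTheorem3 M closed =
  ↔-trans (vertices-⊗ (Biclosed.leftClosed closed (J 1)) (J 1)) (↔-sym *↔×) , CSq⊆J₁⊗J₁ M
  where open PointedTensor M
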